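{- Let $G_0=(V,E_0)$ be a $(k-1)$-edge-connected graph with $k\ge 2$, let $Q\subseteq V$, and let ${\cal T}$ be the family of tight bisets. Then ${\cal T}$ is symmetric and crossing, and any $\mathbb{A},\mathbb{B}\in{\cal T}$ cross or co-cross. Consequently, $\mathbb{C}\subseteq\mathbb{A}$ or $\mathbb{C}\subseteq\mathbb{A}^*$ holds for any $\mathbb{A}\in{\cal T}$ and any ${\cal T}$-core $\mathbb{C}$.
   Context: A biset on $V$ is a pair $\mathbb{A}=(A,A^+)$ with $A\subseteq A^+\subseteq V$; its boundary is $\partial\mathbb{A}=A^+\setminus A$, its co-set is $A^*=V\setminus A^+$, and its co-biset is $\mathbb{A}^*=(V\setminus A^+,V\setminus A)$. $\mathbb{A}$ is proper if $A\ne\emptyset$ and $A^*\neq\emptyset$. $\mathbb{A}\cap\mathbb{B}=(A\cap B,A^+\cap B^+)$, $\mathbb{A}\cup\mathbb{B}=(A\cup B,A^+\cup B^+)$, $\mathbb{A}\subseteq\mathbb{B}$ means $A\subseteq B$ and $A^+\subseteq B^+$. Bisets $\mathbb{A},\mathbb{B}$ cross if $A\cap B\ne\emptyset$ and $A^+\cup B^+\ne V$; they co-cross if $A\setminus B^+$ and $B\setminus A^+$ are both nonempty. A biset family ${\cal F}$ is crossing if $\mathbb{A}\cap\mathbb{B},\mathbb{A}\cup\mathbb{B}\in{\cal F}$ whenever $\mathbb{A},\mathbb{B}\in{\cal F}$ cross, and symmetric if $\mathbb{A}^*\in{\cal F}$ whenever $\mathbb{A}\in{\cal F}$. $d_{G_0}(\mathbb{A})$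 is the number of edges of $G_0$ with one end in $A$ and the other in $A^*$. Node capacities: $q(v)=k-1$ if $v\in Q$ and $q(v)=\infty$ otherwise; $q(S)=\sum_{v\in S}q(v)$. A proper biset $\mathbb{A}$ is tight if $d_{G_0}(\mathbb{A})+q(\partial\mathbb{A})=k-1$; ${\cal T}$ is the family of tight bisets. A ${\cal T}$-core is an inclusion-minimal member of ${\cal T}$. -}

module Defs where

open import Data.Nat using (ℕ; zero; suc; _+_; _∸_; _≤_)
open import Data.Bool using (Bool; true; false; if_then_else_; _∧_; _∨_)
open import Data.Fin using (Fin)
open import Data.Fin.Subset public
  using (Subset; _∩_; _∪_; ∁; ⊤; Nonempty; inside; outside)
  renaming (_⊆_ to _⊆ₛ_)
open import Data.Vec using (Vec; []; _∷_; lookup)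
open import Data.List using (List; []; _∷_)
open import Data.Product using (_×_; _,_; proj₁; proj₂)
open import Data.Maybe using (Maybe; just; nothing)
open import Relation.Binary.PropositionalEquality using (_≡_)
open import Relation.Nullary using (¬_)

Graph : ℕ → Set
Graph n = List (Fin n × Fin n)

Biset : ℕ → Set
Biset n = Subset n × Subset n

IsBiset : ∀ {n} → Biset n → Set
IsBiset (A , A⁺) = A ⊆ₛ A⁺

∂ : ∀ {n} → Biset n → Subset n
∂ (A , A⁺) = A⁺ ∩ ∁ A

coset : ∀ {n} → Biset n → Subset n
coset (A , A⁺) = ∁ A⁺

cobiset : ∀ {n} → Biset n → Biset n
cobiset (A , A⁺) = (∁ A⁺ , ∁ A)

Proper : ∀ {n} → Biset n → Set
Proper 𝔸 = IsBiset 𝔸 × Nonempty (proj₁ 𝔸) × Nonempty (coset 𝔸)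

_∩b_ : ∀ {n} → Biset n → Biset n → Biset n
(A , A⁺) ∩b (B , B⁺) = (A ∩ B , A⁺ ∩ B⁺)

_∪b_ : ∀ {n} → Biset n → Biset n → Biset n
(A , A⁺) ∪b (B , B⁺) = (A ∪ B , A⁺ ∪ B⁺)

_⊆b_ : ∀ {n} → Biset n → Biset n → Set
(A , A⁺) ⊆b (B , B⁺) = (A ⊆ₛ B) × (A⁺ ⊆ₛ B⁺)

Cross : ∀ {n} → Biset n → Biset n → Set
Cross (A , A⁺) (B , B⁺) = Nonempty (A ∩ B) × ¬ (A⁺ ∪ B⁺ ≡ ⊤)

CoCross : ∀ {n} → Biset n → Biset n → Set
CoCross (A , A⁺) (B , B⁺) = Nonempty (A ∩ ∁ B⁺) × Nonempty (B ∩ ∁ A⁺)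

dEdges : ∀ {n} → Graph n → Subset n → Subset n → ℕ
dEdges [] S T = 0
dEdges ((u , v) ∷ es) S T =
  (if (lookup S u ∧ lookup T v) ∨ (lookup S v ∧ lookup T u) then 1 else 0)
  + dEdges es S T

d : ∀ {n} → Graph n → Biset n → ℕ
d G 𝔸 = dEdges G (proj₁ 𝔸) (coset 𝔸)

EdgeConnected : ∀ {n} → ℕ → Graph n → Set
EdgeConnected {n} c G =
  ∀ (S : Subset n) → Nonempty S → Nonempty (∁ S) → c ≤ dEdges G S (∁ S)

-- extended naturals: nothing = ∞
_+∞_ : Maybe ℕ → Maybe ℕ → Maybe ℕ
just a +∞ just b = just (a + b)
_ +∞ _ = nothing

qv : ℕ → Bool → Maybe ℕ
qv k true = just (k ∸ 1)
qv k false = nothing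

qSum : ∀ {n} → ℕ → Subset n → Subset n → Maybe ℕ
qSum k [] [] = just 0
qSum k (b ∷ Q) (true ∷ S) = qv k b +∞ qSum k Q S
qSum k (b ∷ Q) (false ∷ S) = qSum k Q S

Tight : ∀ {n} → ℕ → Graph n → Subset n → Biset n → Set
Tight k G Q 𝔸 = Proper 𝔸 × (just (d G 𝔸) +∞ qSum k Q (∂ 𝔸) ≡ just (k ∸ 1))

Core : ∀ {n} → ℕ → Graph n → Subset n → Biset n → Set
Core k G Q ℂ = Tight k G Q ℂ × (∀ 𝔹 → Tight k G Q 𝔹 → 𝔹 ⊆b ℂ → ℂ ⊆b 𝔹)

module Submission where

-- A biset is tight when its cost d(𝔸) + (k − 1)|∂𝔸| equals k − 1 (which forces
-- ∂𝔸 ⊆ Q), and (k − 1)-edge-connectivity makes k − 1 a lower bound on the cost of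
-- every proper biset. The cost is invariant under 𝔸 ↦ 𝔸* and submodular, because
-- d is submodular and |∂| is modular; for crossing tight 𝔸, 𝔹 the costs of 𝔸 ∩ 𝔹
-- and 𝔸 ∪ 𝔹 are therefore squeezed to k − 1. If tight 𝔸, 𝔹 have A ∩ B = ∅ but
-- A ⊆ B⁺, then A ⊆ ∂𝔹 and the cost equation of 𝔹 force ∂𝔹 = A = {v} and d(𝔹) = 0,
-- so B and B⁺ differ only by v and every edge leaving B or B⁺ is an edge at v;
-- the tightness of 𝔸 then bounds the edges at v so that the cut of B, the cut of
-- B⁺, or their sum violates edge-connectivity. Applied to 𝔸, 𝔹 and to 𝔸*, 𝔹*,
-- this shows that tight bisets cross or co-cross, and a core, being minimal, lies
-- in 𝔸 when it crosses 𝔸 and in 𝔸* when it crosses 𝔸*.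

open import Defs
open import Data.Nat using (ℕ; zero; suc; _+_; _*_; _∸_; _≤_; _≤ᵇ_; z≤n; s≤s)
open import Data.Nat.Properties
  using ( ≤-trans; ≤-reflexive; ≤-antisym; ≤ᵇ⇒≤; m≤m+n; m≤n+m; m≤m*n; +-identityʳ
        ; +-mono-≤; +-monoˡ-≤; +-monoʳ-≤; +-cancelˡ-≤; +-cancelʳ-≤; +-cancelʳ-≡
        ; *-zeroʳ; *-identityʳ; *-suc; *-distribˡ-+; ∸-monoˡ-≤; +-commutativeSemigroup
        ; module ≤-Reasoning )
open import Data.Bool using (Bool; true; false; not; _∧_; _∨_; T; if_then_else_)
open import Data.Bool.Properties using (∧-comm; ∨-comm; T-∧)
open import Data.Unit using (tt)
open import Data.Empty using (⊥; ⊥-elim)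
open import Data.Fin using (Fin; _≟_) renaming (zero to fzero)
open import Data.Fin.Subset using (_∈_; _∉_; Empty; ∣_∣)
import Data.Fin.Subset as Subset
open import Data.Fin.Subset.Properties
  using ( _∈?_; nonempty?; Empty-unique; ∈⊤; ∣⊥∣≡0; ∣⁅x⁆∣≡1; x∈⁅y⁆⇒x≡y; p⊆q⇒∣p∣≤∣q∣
        ; x∈p⇒∣p-x∣<∣p∣; x∈p∧x≢y⇒x∈p-y; ⊆-antisym; drop-∷-⊆; out⊆; in⊆in
        ; x∈p⇒x∉∁p; x∈∁p⇒x∉p; x∉p⇒x∈∁p; p⊆q⇒∁p⊇∁q; p∩q⊆p; p∩q⊆q; x∈p∩q⁺; x∈p∩q⁻
        ; p⊆p∪q; q⊆p∪q; x∈p∪q⁺; x∈p∪q⁻; ∩-comm; ∪-∩-booleanAlgebra )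
open import Data.Vec using (Vec; []; _∷_; lookup; here)
open import Data.Vec.Properties
  using (lookup-zipWith; lookup-map; lookup-replicate; []=⇒lookup; lookup⇒[]=)
open import Data.List using ([]; _∷_)
open import Data.Maybe using (just)
open import Data.Maybe.Properties using (just-injective)
open import Data.Product using (_×_; _,_; proj₁; proj₂; map₁; map₂)
import Data.Product
open import Data.Sum using (_⊎_; inj₁; inj₂; [_,_])
import Data.Sum
open import Function using (_∘_; Equivalence)
open import Relation.Binary.PropositionalEquality hiding ([_])
open import Relation.Nullary using (¬_; yes; no; contradiction)
import Algebra.Lattice.Properties.BooleanAlgebra as BooleanAlgebraProperties
open import Algebra.Properties.CommutativeSemigroup +-commutativeSemigroup using (interchange)

private variable
  n k : ℕ
  x y : Fin n
  p q : Subset n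
  G : Graph n

infixr 3 _⇒ᵇ_
_⇒ᵇ_ : Bool → Bool → Bool
a ⇒ᵇ b = not a ∨ b

⇒ᵇ-intro : ∀ {a b} → (a ≡ true → b ≡ true) → T (a ⇒ᵇ b)
⇒ᵇ-intro {false} _ = tt
⇒ᵇ-intro {true} a⇒b rewrite a⇒b refl = tt

⇒ᵇ-elim : ∀ {a b} → T (a ⇒ᵇ b) → T a → T b
⇒ᵇ-elim {true} t _ = t

infixr 6 _∧ᵀ_
_∧ᵀ_ : ∀ {a b} → T a → T b → T (a ∧ b)
t ∧ᵀ t′ = Equivalence.from T-∧ (t , t′)

𝟙 : Bool → ℕ
𝟙 b = if b then 1 else 0

allBits : ∀ m → (Vec Bool m → Bool) → Bool
allBits zero    φ = φ []
allBits (suc m) φ = allBits m (φ ∘ (true ∷_)) ∧ allBits m (φ ∘ (false ∷_))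

allBits-sound : ∀ m φ → T (allBits m φ) → ∀ bs → T (φ bs)
allBits-sound zero    φ t []           = t
allBits-sound (suc m) φ t (true  ∷ bs) = allBits-sound m _ (proj₁ (Equivalence.to T-∧ t)) bs
allBits-sound (suc m) φ t (false ∷ bs) = allBits-sound m _ (proj₂ (Equivalence.to T-∧ t)) bs

∁-involutive : (p : Subset n) → ∁ (∁ p) ≡ p
∁-involutive {n} = BooleanAlgebraProperties.¬-involutive (∪-∩-booleanAlgebra n)

∁-∪ : (p q : Subset n) → ∁ (p ∪ q) ≡ ∁ p ∩ ∁ q
∁-∪ {n} = BooleanAlgebraProperties.deMorgan₂ (∪-∩-booleanAlgebra n)

Empty-∩-comm : Empty (p ∩ q) → Empty (q ∩ p)
Empty-∩-comm {p = p} {q} p∩q=∅ = p∩q=∅ ∘ subst Nonempty (∩-comm q p)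

∁∩∁∁ : (p q : Subset n) → ∁ p ∩ ∁ (∁ q) ≡ q ∩ ∁ p
∁∩∁∁ p q = trans (cong (∁ p ∩_) (∁-involutive q)) (∩-comm (∁ p) q)

≢⊤⇒∁-nonempty : ¬ p ≡ ⊤ → Nonempty (∁ p)
≢⊤⇒∁-nonempty {n} {p} p≢⊤ with nonempty? (∁ p)
... | yes ne = ne
... | no ∁p=∅ = contradiction p≡⊤ p≢⊤
  where
  p≡⊤ : p ≡ ⊤
  p≡⊤ = begin
    p         ≡⟨ ∁-involutive p ⟨
    ∁ (∁ p)   ≡⟨ cong ∁ (Empty-unique ∁p=∅) ⟩
    ∁ Subset.⊥ ≡⟨ BooleanAlgebraProperties.¬⊥≈⊤ (∪-∩-booleanAlgebra n) ⟩
    ⊤         ∎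
    where open ≡-Reasoning

∁-nonempty⇒≢⊤ : Nonempty (∁ p) → ¬ p ≡ ⊤
∁-nonempty⇒≢⊤ (x , x∈∁p) refl = x∈∁p⇒x∉p x∈∁p ∈⊤

⊆⇒⇒ᵇ : p ⊆ₛ q → ∀ x → T (lookup p x ⇒ᵇ lookup q x)
⊆⇒⇒ᵇ {p = p} p⊆q x = ⇒ᵇ-intro (λ px → []=⇒lookup (p⊆q (lookup⇒[]= x p px)))

x∈p⇒∣p∣≥1 : x ∈ p → 1 ≤ ∣ p ∣
x∈p⇒∣p∣≥1 {x = x} {p} x∈p = subst (_≤ ∣ p ∣) (∣⁅x⁆∣≡1 x)
  (p⊆q⇒∣p∣≤∣q∣ (λ y∈⁅x⁆ → subst (_∈ p) (sym (x∈⁅y⁆⇒x≡y x y∈⁅x⁆)) x∈p))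

∣p∣≡0⇒Empty : ∣ p ∣ ≡ 0 → Empty p
∣p∣≡0⇒Empty ∣p∣≡0 (_ , x∈p) = contradiction (subst (1 ≤_) ∣p∣≡0 (x∈p⇒∣p∣≥1 x∈p)) λ ()

∣p∣≡1⇒Nonempty : ∣ p ∣ ≡ 1 → Nonempty p
∣p∣≡1⇒Nonempty {n} {p} ∣p∣≡1 with nonempty? p
... | yes ne = ne
... | no p=∅ = contradiction (trans (sym ∣p∣≡1) (trans (cong ∣_∣ (Empty-unique p=∅)) (∣⊥∣≡0 n))) λ ()

∣p∣≤1⇒x≡y : ∣ p ∣ ≤ 1 → x ∈ p → y ∈ p → x ≡ y
∣p∣≤1⇒x≡y {p = p} {x} {y} ∣p∣≤1 x∈p y∈p with x ≟ y
... | yes x≡y = x≡y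
... | no x≢y = contradiction (≤-trans ∣p-y∣<∣p∣ ∣p∣≤1) λ { (s≤s ()) }
  where
  ∣p-y∣<∣p∣ : 1 + 1 ≤ ∣ p ∣
  ∣p-y∣<∣p∣ = ≤-trans (s≤s (x∈p⇒∣p∣≥1 (x∈p∧x≢y⇒x∈p-y x∈p x≢y))) (x∈p⇒∣p-x∣<∣p∣ y∈p)

Σedges : Graph n → (Fin n → Fin n → ℕ) → ℕ
Σedges []             f = 0
Σedges ((u , v) ∷ G) f = f u v + Σedges G f

Σedges-+ : ∀ (G : Graph n) f g → Σedges G (λ u v → f u v + g u v) ≡ Σedges G f + Σedges G g
Σedges-+ []             f g = refl
Σedges-+ ((u , v) ∷ G) f g =
  trans (cong (f u v + g u v +_) (Σedges-+ G f g)) (interchange (f u v) (g u v) _ _)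

Σedges-cong : ∀ (G : Graph n) {f g} → (∀ u v → f u v ≡ g u v) → Σedges G f ≡ Σedges G g
Σedges-cong []             f≡g = refl
Σedges-cong ((u , v) ∷ G) f≡g = cong₂ _+_ (f≡g u v) (Σedges-cong G f≡g)

Σedges-mono : ∀ (G : Graph n) {f g} → (∀ u v → f u v ≤ g u v) → Σedges G f ≤ Σedges G g
Σedges-mono []             f≤g = z≤n
Σedges-mono ((u , v) ∷ G) f≤g = +-mono-≤ (f≤g u v) (Σedges-mono G f≤g)

Σedges-labelwise : ∀ {m} (ok : Vec Bool m → Bool) (f g : Vec Bool m → Vec Bool m → ℕ) →
  T (allBits m λ a → allBits m λ b → ok a ∧ ok b ⇒ᵇ f a b ≤ᵇ g a b) →
  (ℓ : Fin n → Vec Bool m) → (∀ x → T (ok (ℓ x))) →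
  ∀ G → Σedges G (λ u v → f (ℓ u) (ℓ v)) ≤ Σedges G (λ u v → g (ℓ u) (ℓ v))
Σedges-labelwise {m = m} ok f g check ℓ ok-ℓ G = Σedges-mono G λ u v →
  ≤ᵇ⇒≤ _ _ (⇒ᵇ-elim (allBits-sound m _ (allBits-sound m _ check (ℓ u)) (ℓ v))
                 (ok-ℓ u ∧ᵀ ok-ℓ v))

dEdges-comm : ∀ (G : Graph n) S T → dEdges G S T ≡ dEdges G T S
dEdges-comm []             S T = refl
dEdges-comm ((u , v) ∷ G) S T = cong₂ _+_ (cong 𝟙 edge) (dEdges-comm G S T)
  where
  edge : (lookup S u ∧ lookup T v) ∨ (lookup S v ∧ lookup T u)
       ≡ (lookup T u ∧ lookup S v) ∨ (lookup T v ∧ lookup S u)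
  edge = trans (∨-comm (lookup S u ∧ lookup T v) _)
               (cong₂ _∨_ (∧-comm (lookup S v) _) (∧-comm (lookup S u) _))

crossing : Bool × Bool → Bool × Bool → ℕ
crossing (x , x⁺) (y , y⁺) = 𝟙 (x ∧ not y⁺ ∨ y ∧ not x⁺)

membership : Biset n → Fin n → Bool × Bool
membership (X , X⁺) x = lookup X x , lookup X⁺ x

dₑ : Biset n → Fin n → Fin n → ℕ
dₑ 𝕏 u v = crossing (membership 𝕏 u) (membership 𝕏 v)

d≡Σdₑ : ∀ (G : Graph n) 𝕏 → d G 𝕏 ≡ Σedges G (dₑ 𝕏)
d≡Σdₑ []             𝕏         = refl
d≡Σdₑ ((u , v) ∷ G) (X , X⁺) = cong₂ _+_ edge (d≡Σdₑ G (X , X⁺))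
  where
  edge : 𝟙 (lookup X u ∧ lookup (∁ X⁺) v ∨ lookup X v ∧ lookup (∁ X⁺) u) ≡ dₑ (X , X⁺) u v
  edge rewrite lookup-map v not X⁺ | lookup-map u not X⁺ = refl

d+d≡Σ : ∀ (G : Graph n) 𝕏 𝕐 → d G 𝕏 + d G 𝕐 ≡ Σedges G (λ u v → dₑ 𝕏 u v + dₑ 𝕐 u v)
d+d≡Σ G 𝕏 𝕐 = trans (cong₂ _+_ (d≡Σdₑ G 𝕏) (d≡Σdₑ G 𝕐)) (sym (Σedges-+ G (dₑ 𝕏) (dₑ 𝕐)))

-- Every cut below is d(𝕏) for a biset 𝕏 built from 𝔸 and 𝔹, and it counts an edge
-- according to the profiles (memberships in A, A⁺, B, B⁺) of its two ends only.
-- Edge-wise inequalities between such cuts are thus Boolean facts about pairs of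
-- profiles, discharged by evaluation through Σedges-labelwise (the argument tt).
Profile : Set
Profile = Vec Bool 4

profile : Biset n → Biset n → Fin n → Profile
profile (A , A⁺) (B , B⁺) x = lookup A x ∷ lookup A⁺ x ∷ lookup B x ∷ lookup B⁺ x ∷ []

𝔸ᵖ 𝔹ᵖ 𝔸∩𝔹ᵖ 𝔸∪𝔹ᵖ Bᵖ B⁺ᵖ : Profile → Bool × Bool
𝔸ᵖ    (a ∷ a⁺ ∷ b ∷ b⁺ ∷ []) = a , a⁺
𝔹ᵖ    (a ∷ a⁺ ∷ b ∷ b⁺ ∷ []) = b , b⁺
𝔸∩𝔹ᵖ (a ∷ a⁺ ∷ b ∷ b⁺ ∷ []) = a ∧ b , a⁺ ∧ b⁺
𝔸∪𝔹ᵖ (a ∷ a⁺ ∷ b ∷ b⁺ ∷ []) = a ∨ b , a⁺ ∨ b⁺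
Bᵖ    (a ∷ a⁺ ∷ b ∷ b⁺ ∷ []) = b , b
B⁺ᵖ   (a ∷ a⁺ ∷ b ∷ b⁺ ∷ []) = b⁺ , b⁺

cutᵖ : (Profile → Bool × Bool) → Profile → Profile → ℕ
cutᵖ 𝕊 a b = crossing (𝕊 a) (𝕊 b)

bisetsᵖ : Profile → Bool
bisetsᵖ (a ∷ a⁺ ∷ b ∷ b⁺ ∷ []) = (a ⇒ᵇ a⁺) ∧ (b ⇒ᵇ b⁺)

d-submodular : ∀ (G : Graph n) {𝔸 𝔹} → IsBiset 𝔸 → IsBiset 𝔹 →
  d G (𝔸 ∩b 𝔹) + d G (𝔸 ∪b 𝔹) ≤ d G 𝔸 + d G 𝔹
d-submodular G {𝔸@(A , A⁺)} {𝔹@(B , B⁺)} A⊆A⁺ B⊆B⁺ = begin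
  d G (𝔸 ∩b 𝔹) + d G (𝔸 ∪b 𝔹)
    ≡⟨ d+d≡Σ G (𝔸 ∩b 𝔹) (𝔸 ∪b 𝔹) ⟩
  Σedges G (λ u v → dₑ (𝔸 ∩b 𝔹) u v + dₑ (𝔸 ∪b 𝔹) u v)
    ≡⟨ Σedges-cong G (λ u v → cong₂ _+_ (cong₂ crossing (membership-∩ u) (membership-∩ v))
                                          (cong₂ crossing (membership-∪ u) (membership-∪ v))) ⟩
  Σedges G (λ u v → cutᵖ 𝔸∩𝔹ᵖ (ℓ u) (ℓ v) + cutᵖ 𝔸∪𝔹ᵖ (ℓ u) (ℓ v))
    ≤⟨ Σedges-labelwise bisetsᵖ
         (λ a b → cutᵖ 𝔸∩𝔹ᵖ a b + cutᵖ 𝔸∪𝔹ᵖ a b) (λ a b → cutᵖ 𝔸ᵖ a b + cutᵖ 𝔹ᵖ a b)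
         tt ℓ (λ x → ⊆⇒⇒ᵇ A⊆A⁺ x ∧ᵀ ⊆⇒⇒ᵇ B⊆B⁺ x) G ⟩
  Σedges G (λ u v → dₑ 𝔸 u v + dₑ 𝔹 u v)
    ≡⟨ d+d≡Σ G 𝔸 𝔹 ⟨
  d G 𝔸 + d G 𝔹 ∎
  where
  open ≤-Reasoning
  ℓ = profile 𝔸 𝔹
  membership-∩ : ∀ x → membership (𝔸 ∩b 𝔹) x ≡ 𝔸∩𝔹ᵖ (ℓ x)
  membership-∩ x = cong₂ _,_ (lookup-zipWith _∧_ x A B) (lookup-zipWith _∧_ x A⁺ B⁺)
  membership-∪ : ∀ x → membership (𝔸 ∪b 𝔹) x ≡ 𝔸∪𝔹ᵖ (ℓ x)
  membership-∪ x = cong₂ _,_ (lookup-zipWith _∨_ x A B) (lookup-zipWith _∨_ x A⁺ B⁺)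

∈∂ : ∀ {A A⁺ : Subset n} → x ∈ A⁺ → x ∉ A → x ∈ ∂ (A , A⁺)
∈∂ x∈A⁺ x∉A = x∈p∩q⁺ (x∈A⁺ , x∉p⇒x∈∁p x∉A)

∂⊆⁺ : ∀ {A A⁺ : Subset n} → x ∈ ∂ (A , A⁺) → x ∈ A⁺
∂⊆⁺ = p∩q⊆p _ _

∂∌ : ∀ {A A⁺ : Subset n} → x ∈ ∂ (A , A⁺) → x ∉ A
∂∌ = x∈∁p⇒x∉p ∘ p∩q⊆q _ _

∂⊆⇒⁺⊆∪ : ∀ {A A⁺ : Subset n} → ∂ (A , A⁺) ⊆ₛ q → A⁺ ⊆ₛ A ∪ q
∂⊆⇒⁺⊆∪ {A = A} ∂⊆q {x} x∈A⁺ with x ∈? A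
... | yes x∈A = x∈p∪q⁺ (inj₁ x∈A)
... | no  x∉A = x∈p∪q⁺ (inj₂ (∂⊆q (∈∂ x∈A⁺ x∉A)))

∂-cobiset : (𝔸 : Biset n) → ∂ (cobiset 𝔸) ≡ ∂ 𝔸
∂-cobiset (A , A⁺) = ∁∩∁∁ A A⁺

∂-∩⊆ : ∀ (𝔸 𝔹 : Biset n) → ∂ (𝔸 ∩b 𝔹) ⊆ₛ ∂ 𝔸 ∪ ∂ 𝔹
∂-∩⊆ (A , A⁺) (B , B⁺) {x} x∈∂ with x∈p∩q⁻ A⁺ B⁺ (∂⊆⁺ x∈∂) | x ∈? A
... | x∈A⁺ , x∈B⁺ | yes x∈A = x∈p∪q⁺ (inj₂ (∈∂ x∈B⁺ λ x∈B → ∂∌ x∈∂ (x∈p∩q⁺ (x∈A , x∈B))))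
... | x∈A⁺ , x∈B⁺ | no  x∉A = x∈p∪q⁺ (inj₁ (∈∂ x∈A⁺ x∉A))

∂-∪⊆ : ∀ (𝔸 𝔹 : Biset n) → ∂ (𝔸 ∪b 𝔹) ⊆ₛ ∂ 𝔸 ∪ ∂ 𝔹
∂-∪⊆ (A , A⁺) (B , B⁺) {x} x∈∂ with x∈p∪q⁻ A⁺ B⁺ (∂⊆⁺ x∈∂)
... | inj₁ x∈A⁺ = x∈p∪q⁺ (inj₁ (∈∂ x∈A⁺ (∂∌ x∈∂ ∘ p⊆p∪q B)))
... | inj₂ x∈B⁺ = x∈p∪q⁺ (inj₂ (∈∂ x∈B⁺ (∂∌ x∈∂ ∘ q⊆p∪q A B)))

∂-modularᵇ : ∀ a a⁺ b b⁺ → T (a ⇒ᵇ a⁺) → T (b ⇒ᵇ b⁺) →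
  𝟙 ((a⁺ ∧ b⁺) ∧ not (a ∧ b)) + 𝟙 ((a⁺ ∨ b⁺) ∧ not (a ∨ b)) ≡ 𝟙 (a⁺ ∧ not a) + 𝟙 (b⁺ ∧ not b)
∂-modularᵇ false false false false _ _ = refl
∂-modularᵇ false false false true  _ _ = refl
∂-modularᵇ false false true  true  _ _ = refl
∂-modularᵇ false true  false false _ _ = refl
∂-modularᵇ false true  false true  _ _ = refl
∂-modularᵇ false true  true  true  _ _ = refl
∂-modularᵇ true  true  false false _ _ = refl
∂-modularᵇ true  true  false true  _ _ = refl
∂-modularᵇ true  true  true  true  _ _ = refl
∂-modularᵇ true  false _     _     () _
∂-modularᵇ _     _     true  false _ ()

∣∷∣ : ∀ b (p : Subset n) → ∣ b ∷ p ∣ ≡ 𝟙 b + ∣ p ∣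
∣∷∣ true  p = refl
∣∷∣ false p = refl

∣∂∣-modular : ∀ (𝔸 𝔹 : Biset n) → IsBiset 𝔸 → IsBiset 𝔹 →
  ∣ ∂ (𝔸 ∩b 𝔹) ∣ + ∣ ∂ (𝔸 ∪b 𝔹) ∣ ≡ ∣ ∂ 𝔸 ∣ + ∣ ∂ 𝔹 ∣
∣∂∣-modular ([] , []) ([] , []) _ _ = refl
∣∂∣-modular (a ∷ A , a⁺ ∷ A⁺) (b ∷ B , b⁺ ∷ B⁺) A⊆A⁺ B⊆B⁺ = begin
  ∣ ∂∩ ∷ ∂ (𝔸 ∩b 𝔹) ∣ + ∣ ∂∪ ∷ ∂ (𝔸 ∪b 𝔹) ∣
    ≡⟨ cong₂ _+_ (∣∷∣ ∂∩ (∂ (𝔸 ∩b 𝔹))) (∣∷∣ ∂∪ (∂ (𝔸 ∪b 𝔹))) ⟩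
  (𝟙 ∂∩ + ∣ ∂ (𝔸 ∩b 𝔹) ∣) + (𝟙 ∂∪ + ∣ ∂ (𝔸 ∪b 𝔹) ∣)
    ≡⟨ interchange (𝟙 ∂∩) _ (𝟙 ∂∪) _ ⟩
  (𝟙 ∂∩ + 𝟙 ∂∪) + (∣ ∂ (𝔸 ∩b 𝔹) ∣ + ∣ ∂ (𝔸 ∪b 𝔹) ∣)
    ≡⟨ cong₂ _+_ (∂-modularᵇ a a⁺ b b⁺ (⊆⇒⇒ᵇ A⊆A⁺ fzero) (⊆⇒⇒ᵇ B⊆B⁺ fzero))
                 (∣∂∣-modular 𝔸 𝔹 (drop-∷-⊆ A⊆A⁺) (drop-∷-⊆ B⊆B⁺)) ⟩
  (𝟙 ∂a + 𝟙 ∂b) + (∣ ∂ 𝔸 ∣ + ∣ ∂ 𝔹 ∣)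
    ≡⟨ interchange (𝟙 ∂a) _ (𝟙 ∂b) _ ⟨
  (𝟙 ∂a + ∣ ∂ 𝔸 ∣) + (𝟙 ∂b + ∣ ∂ 𝔹 ∣)
    ≡⟨ cong₂ _+_ (∣∷∣ ∂a (∂ 𝔸)) (∣∷∣ ∂b (∂ 𝔹)) ⟨
  ∣ ∂a ∷ ∂ 𝔸 ∣ + ∣ ∂b ∷ ∂ 𝔹 ∣ ∎
  where
  open ≡-Reasoning
  𝔸 = A , A⁺
  𝔹 = B , B⁺
  ∂∩ = (a⁺ ∧ b⁺) ∧ not (a ∧ b)
  ∂∪ = (a⁺ ∨ b⁺) ∧ not (a ∨ b)
  ∂a = a⁺ ∧ not a
  ∂b = b⁺ ∧ not b

-- q(∂𝔸) is finite exactly when ∂𝔸 ⊆ Q, and then equals (k − 1)|∂𝔸|; IsTight is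
-- Tight with the sum over ℕ ∪ {∞} unfolded in this way.
cost : ℕ → Graph n → Biset n → ℕ
cost k G 𝔸 = d G 𝔸 + (k ∸ 1) * ∣ ∂ 𝔸 ∣

record IsTight (k : ℕ) (G : Graph n) (Q : Subset n) (𝔸 : Biset n) : Set where
  field
    proper   : Proper 𝔸
    ∂⊆Q      : ∂ 𝔸 ⊆ₛ Q
    balanced : cost k G 𝔸 ≡ k ∸ 1

qSum-just⇒ : ∀ {k m} (Q S : Subset n) → qSum k Q S ≡ just m → S ⊆ₛ Q × m ≡ (k ∸ 1) * ∣ S ∣
qSum-just⇒ {k = k} [] [] refl = (λ ()) , sym (*-zeroʳ (k ∸ 1))
qSum-just⇒ (b ∷ Q) (false ∷ S) eq = map₁ out⊆ (qSum-just⇒ Q S eq)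
qSum-just⇒ {k = k} (true ∷ Q) (true ∷ S) eq with qSum k Q S in eqS
qSum-just⇒ {k = k} (true ∷ Q) (true ∷ S) refl | just m with qSum-just⇒ Q S eqS
... | S⊆Q , refl = in⊆in S⊆Q , sym (*-suc (k ∸ 1) ∣ S ∣)

⊆⇒qSum-just : ∀ {k} (Q S : Subset n) → S ⊆ₛ Q → qSum k Q S ≡ just ((k ∸ 1) * ∣ S ∣)
⊆⇒qSum-just {k = k} [] [] _ = cong just (sym (*-zeroʳ (k ∸ 1)))
⊆⇒qSum-just (b ∷ Q) (false ∷ S) S⊆Q = ⊆⇒qSum-just Q S (drop-∷-⊆ S⊆Q)
⊆⇒qSum-just {k = k} (b ∷ Q) (true ∷ S) S⊆Q with S⊆Q here
... | here rewrite ⊆⇒qSum-just {k = k} Q S (drop-∷-⊆ S⊆Q) = cong just (sym (*-suc (k ∸ 1) ∣ S ∣))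

module _ {k : ℕ} {G : Graph n} {Q : Subset n} where

  Tight⇒IsTight : ∀ {𝔸} → Tight k G Q 𝔸 → IsTight k G Q 𝔸
  Tight⇒IsTight {𝔸} (proper , q-balanced) with qSum k Q (∂ 𝔸) in eq
  ... | just m with qSum-just⇒ Q (∂ 𝔸) eq
  ...   | ∂⊆Q , refl = record { proper = proper ; ∂⊆Q = ∂⊆Q ; balanced = just-injective q-balanced }

  IsTight⇒Tight : ∀ {𝔸} → IsTight k G Q 𝔸 → Tight k G Q 𝔸
  IsTight⇒Tight {𝔸} t = proper , q-balanced
    where
    open IsTight t
    q-balanced : just (d G 𝔸) +∞ qSum k Q (∂ 𝔸) ≡ just (k ∸ 1)
    q-balanced rewrite ⊆⇒qSum-just {k = k} Q (∂ 𝔸) ∂⊆Q = cong just balanced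

∂-empty⇒⁺≡ : ∀ {A A⁺ : Subset n} → A ⊆ₛ A⁺ → Empty (∂ (A , A⁺)) → A⁺ ≡ A
∂-empty⇒⁺≡ {A = A} A⊆A⁺ ∂=∅ = ⊆-antisym A⁺⊆A A⊆A⁺
  where
  A⁺⊆A : _ ⊆ₛ A
  A⁺⊆A {x} x∈A⁺ with x ∈? A
  ... | yes x∈A = x∈A
  ... | no  x∉A = contradiction (x , ∈∂ x∈A⁺ x∉A) ∂=∅

k∸1≤cost : ∀ k (G : Graph n) → EdgeConnected (k ∸ 1) G → ∀ {𝔸} → Proper 𝔸 → k ∸ 1 ≤ cost k G 𝔸
k∸1≤cost k G ec {A , A⁺} (A⊆A⁺ , A≠∅ , A*≠∅) with ∣ ∂ (A , A⁺) ∣ in ∣∂∣≡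
... | zero = begin
  k ∸ 1                             ≤⟨ ec A A≠∅ (subst (Nonempty ∘ ∁) A⁺≡A A*≠∅) ⟩
  dEdges G A (∁ A)                  ≡⟨ cong (dEdges G A ∘ ∁) A⁺≡A ⟨
  dEdges G A (∁ A⁺)                 ≤⟨ m≤m+n _ _ ⟩
  dEdges G A (∁ A⁺) + (k ∸ 1) * 0   ∎
  where
  open ≤-Reasoning
  A⁺≡A = ∂-empty⇒⁺≡ A⊆A⁺ (∣p∣≡0⇒Empty ∣∂∣≡)
... | suc c = ≤-trans (m≤m*n (k ∸ 1) (suc c)) (m≤n+m _ _)

d-cobiset : ∀ (G : Graph n) 𝔸 → d G (cobiset 𝔸) ≡ d G 𝔸
d-cobiset G (A , A⁺) = trans (cong (dEdges G (∁ A⁺)) (∁-involutive A)) (dEdges-comm G (∁ A⁺) A)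

IsTight-cobiset : ∀ {Q : Subset n} {𝔸} → IsTight k G Q 𝔸 → IsTight k G Q (cobiset 𝔸)
IsTight-cobiset {k = k} {G = G} {Q} {𝔸 = 𝔸@(A , A⁺)} t = record
  { proper   = p⊆q⇒∁p⊇∁q A⊆A⁺ , A*≠∅ , subst Nonempty (sym (∁-involutive A)) A≠∅
  ; ∂⊆Q      = subst (_⊆ₛ Q) (sym (∂-cobiset 𝔸)) ∂⊆Q
  ; balanced = trans (cong₂ (λ δ ∂𝔸 → δ + (k ∸ 1) * ∣ ∂𝔸 ∣) (d-cobiset G 𝔸) (∂-cobiset 𝔸)) balanced
  }
  where
  open IsTight t
  A⊆A⁺ = proj₁ proper
  A≠∅  = proj₁ (proj₂ proper)
  A*≠∅ = proj₂ (proj₂ proper)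

cost-submodular : ∀ k (G : Graph n) 𝔸 𝔹 → IsBiset 𝔸 → IsBiset 𝔹 →
  cost k G (𝔸 ∩b 𝔹) + cost k G (𝔸 ∪b 𝔹) ≤ cost k G 𝔸 + cost k G 𝔹
cost-submodular k G 𝔸 𝔹 A⊆A⁺ B⊆B⁺ = begin
  cost k G (𝔸 ∩b 𝔹) + cost k G (𝔸 ∪b 𝔹)
    ≡⟨ regroup (d G (𝔸 ∩b 𝔹)) _ (d G (𝔸 ∪b 𝔹)) _ ⟩
  (d G (𝔸 ∩b 𝔹) + d G (𝔸 ∪b 𝔹)) + (k ∸ 1) * (∣ ∂ (𝔸 ∩b 𝔹) ∣ + ∣ ∂ (𝔸 ∪b 𝔹) ∣)
    ≤⟨ +-mono-≤ (d-submodular G A⊆A⁺ B⊆B⁺)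
                (≤-reflexive (cong ((k ∸ 1) *_) (∣∂∣-modular 𝔸 𝔹 A⊆A⁺ B⊆B⁺))) ⟩
  (d G 𝔸 + d G 𝔹) + (k ∸ 1) * (∣ ∂ 𝔸 ∣ + ∣ ∂ 𝔹 ∣)
    ≡⟨ regroup (d G 𝔸) _ (d G 𝔹) _ ⟨
  cost k G 𝔸 + cost k G 𝔹 ∎
  where
  open ≤-Reasoning
  regroup : ∀ a x b y → (a + (k ∸ 1) * x) + (b + (k ∸ 1) * y) ≡ (a + b) + (k ∸ 1) * (x + y)
  regroup a x b y = trans (interchange a _ b _) (cong (a + b +_) (sym (*-distribˡ-+ (k ∸ 1) x y)))

cross⇒proper : ∀ {𝔸 𝔹 : Biset n} → IsBiset 𝔸 → IsBiset 𝔹 → Cross 𝔸 𝔹 →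
  Proper (𝔸 ∩b 𝔹) × Proper (𝔸 ∪b 𝔹)
cross⇒proper {𝔸 = A , A⁺} {B , B⁺} A⊆A⁺ B⊆B⁺ (A∩B≠∅ , A⁺∪B⁺≢⊤) =
    ((λ x∈A∩B → let x∈A , x∈B = x∈p∩q⁻ A B x∈A∩B in x∈p∩q⁺ (A⊆A⁺ x∈A , B⊆B⁺ x∈B))
    , A∩B≠∅
    , map₂ (p⊆q⇒∁p⊇∁q (p⊆p∪q B⁺ ∘ p∩q⊆p A⁺ B⁺)) ∁[A⁺∪B⁺]≠∅)
  , ((λ x∈A∪B → x∈p∪q⁺ (Data.Sum.map A⊆A⁺ B⊆B⁺ (x∈p∪q⁻ A B x∈A∪B)))
    , map₂ (p⊆p∪q B ∘ p∩q⊆p A B) A∩B≠∅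
    , ∁[A⁺∪B⁺]≠∅)
  where ∁[A⁺∪B⁺]≠∅ = ≢⊤⇒∁-nonempty A⁺∪B⁺≢⊤

+-squeeze : ∀ {c x y} → c ≤ x → c ≤ y → x + y ≤ c + c → x ≡ c × y ≡ c
+-squeeze {c} {x} {y} c≤x c≤y x+y≤c+c =
    ≤-antisym (+-cancelʳ-≤ c x c (≤-trans (+-monoʳ-≤ x c≤y) x+y≤c+c)) c≤x
  , ≤-antisym (+-cancelˡ-≤ c y c (≤-trans (+-monoˡ-≤ y c≤x) x+y≤c+c)) c≤y

IsTight-∩∪ : ∀ {Q : Subset n} → EdgeConnected (k ∸ 1) G → ∀ {𝔸 𝔹} →
  IsTight k G Q 𝔸 → IsTight k G Q 𝔹 → Cross 𝔸 𝔹 → IsTight k G Q (𝔸 ∩b 𝔹) × IsTight k G Q (𝔸 ∪b 𝔹)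
IsTight-∩∪ {k = k} {G = G} ec {𝔸} {𝔹} t𝔸 t𝔹 cross =
    record { proper = proper∩ ; ∂⊆Q = ∂∪∂⊆Q ∘ ∂-∩⊆ 𝔸 𝔹 ; balanced = proj₁ balanced∩∪ }
  , record { proper = proper∪ ; ∂⊆Q = ∂∪∂⊆Q ∘ ∂-∪⊆ 𝔸 𝔹 ; balanced = proj₂ balanced∩∪ }
  where
  open IsTight t𝔸 renaming (proper to proper𝔸; ∂⊆Q to ∂𝔸⊆Q; balanced to balanced𝔸)
  open IsTight t𝔹 renaming (proper to proper𝔹; ∂⊆Q to ∂𝔹⊆Q; balanced to balanced𝔹)
  ∂∪∂⊆Q : ∂ 𝔸 ∪ ∂ 𝔹 ⊆ₛ _
  ∂∪∂⊆Q = [ ∂𝔸⊆Q , ∂𝔹⊆Q ] ∘ x∈p∪q⁻ (∂ 𝔸) (∂ 𝔹)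
  proper∩ = proj₁ (cross⇒proper (proj₁ proper𝔸) (proj₁ proper𝔹) cross)
  proper∪ = proj₂ (cross⇒proper (proj₁ proper𝔸) (proj₁ proper𝔹) cross)
  balanced∩∪ = +-squeeze (k∸1≤cost k G ec proper∩) (k∸1≤cost k G ec proper∪)
    (subst (cost k G (𝔸 ∩b 𝔹) + cost k G (𝔸 ∪b 𝔹) ≤_) (cong₂ _+_ balanced𝔸 balanced𝔹)
           (cost-submodular k G 𝔸 𝔹 (proj₁ proper𝔸) (proj₁ proper𝔹)))

balance-cases : ∀ {c δ m} → 1 ≤ c → δ + c * m ≡ c → (m ≡ 0 × δ ≡ c) ⊎ (m ≡ 1 × δ ≡ 0)
balance-cases {c} {δ} {zero} _ eq =
  inj₁ (refl , trans (sym (trans (cong (δ +_) (*-zeroʳ c)) (+-identityʳ δ))) eq)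
balance-cases {c} {δ} {suc zero} _ eq =
  inj₂ (refl , +-cancelʳ-≡ c δ 0 (trans (cong (δ +_) (sym (*-identityʳ c))) eq))
balance-cases {c} {δ} {suc (suc m)} 1≤c eq = contradiction (≤-trans 1≤c c≤0) λ ()
  where
  c≤0 : c ≤ 0
  c≤0 = +-cancelˡ-≤ c c 0 (begin
    c + c                 ≤⟨ +-monoʳ-≤ c (m≤m+n c (c * m)) ⟩
    c + (c + c * m)       ≡⟨ trans (*-suc c (suc m)) (cong (c +_) (*-suc c m)) ⟨
    c * suc (suc m)       ≤⟨ m≤n+m _ δ ⟩
    δ + c * suc (suc m)   ≡⟨ eq ⟩
    c                     ≡⟨ +-identityʳ c ⟨
    c + 0                 ∎)
    where open ≤-Reasoning

IsTight-cases : ∀ {Q : Subset n} {𝔸} → 2 ≤ k → IsTight k G Q 𝔸 →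
  (∣ ∂ 𝔸 ∣ ≡ 0 × d G 𝔸 ≡ k ∸ 1) ⊎ (∣ ∂ 𝔸 ∣ ≡ 1 × d G 𝔸 ≡ 0)
IsTight-cases k≥2 t = balance-cases (∸-monoˡ-≤ 1 k≥2) (IsTight.balanced t)

-- Vertex-wise form of A ⊆ A⁺, B ⊆ B⁺, A = ∂𝔹 and A⁺ ⊆ A ∪ E, where e decides E.
insideBoundaryᵖ : (Profile → Bool) → Profile → Bool
insideBoundaryᵖ e p@(a ∷ a⁺ ∷ b ∷ b⁺ ∷ []) =
  (a ⇒ᵇ a⁺) ∧ (b ⇒ᵇ b⁺) ∧ (a ⇒ᵇ b⁺ ∧ not b) ∧ (b⁺ ∧ not b ⇒ᵇ a) ∧ (a⁺ ⇒ᵇ a ∨ e p)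

module _ {k : ℕ} {G : Graph n} {Q : Subset n} (k≥2 : 2 ≤ k) (ec : EdgeConnected (k ∸ 1) G)
         {A A⁺ B B⁺ : Subset n} (t𝔸 : IsTight k G Q (A , A⁺)) (t𝔹 : IsTight k G Q (B , B⁺))
         (A∩B=∅ : Empty (A ∩ B)) (A⊆B⁺ : A ⊆ₛ B⁺) where

  private
    𝔸 𝔹 : Biset n
    𝔸 = A , A⁺
    𝔹 = B , B⁺
    ℓ = profile 𝔸 𝔹
    A⊆A⁺ = proj₁ (IsTight.proper t𝔸)
    B⊆B⁺ = proj₁ (IsTight.proper t𝔹)
    A≠∅  = proj₁ (proj₂ (IsTight.proper t𝔸))
    B≠∅  = proj₁ (proj₂ (IsTight.proper t𝔹))
    B*≠∅ = proj₂ (proj₂ (IsTight.proper t𝔹))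
    1≤k∸1 : 1 ≤ k ∸ 1
    1≤k∸1 = ∸-monoˡ-≤ 1 k≥2

  A⊆∂𝔹 : A ⊆ₛ ∂ 𝔹
  A⊆∂𝔹 x∈A = ∈∂ (A⊆B⁺ x∈A) (λ x∈B → A∩B=∅ (_ , x∈p∩q⁺ (x∈A , x∈B)))

  ∣∂𝔹∣≡1×d𝔹≡0 : ∣ ∂ 𝔹 ∣ ≡ 1 × d G 𝔹 ≡ 0
  ∣∂𝔹∣≡1×d𝔹≡0 with IsTight-cases k≥2 t𝔹
  ... | inj₁ (∣∂𝔹∣≡0 , _) = contradiction (map₂ A⊆∂𝔹 A≠∅) (∣p∣≡0⇒Empty ∣∂𝔹∣≡0)
  ... | inj₂ singleton    = singleton

  ∂𝔹⊆A : ∂ 𝔹 ⊆ₛ A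
  ∂𝔹⊆A x∈∂𝔹 = let a , a∈A = A≠∅ in
    subst (_∈ A) (∣p∣≤1⇒x≡y (≤-reflexive (proj₁ ∣∂𝔹∣≡1×d𝔹≡0)) (A⊆∂𝔹 a∈A) x∈∂𝔹) a∈A

  insideBoundary : ∀ {E} e → (∀ x → lookup E x ≡ e (ℓ x)) → ∂ 𝔸 ⊆ₛ E →
    ∀ x → T (insideBoundaryᵖ e (ℓ x))
  insideBoundary {E} e E≡e ∂𝔸⊆E x =
        ⊆⇒⇒ᵇ A⊆A⁺ x
    ∧ᵀ ⊆⇒⇒ᵇ B⊆B⁺ x
    ∧ᵀ subst (λ b → T (lookup A x ⇒ᵇ b)) ∂𝔹-at-x (⊆⇒⇒ᵇ A⊆∂𝔹 x)
    ∧ᵀ subst (λ b → T (b ⇒ᵇ lookup A x)) ∂𝔹-at-x (⊆⇒⇒ᵇ ∂𝔹⊆A x)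
    ∧ᵀ subst (λ b → T (lookup A⁺ x ⇒ᵇ b)) A∪E-at-x (⊆⇒⇒ᵇ (∂⊆⇒⁺⊆∪ ∂𝔸⊆E) x)
    where
    ∂𝔹-at-x : lookup (∂ 𝔹) x ≡ (lookup B⁺ x ∧ not (lookup B x))
    ∂𝔹-at-x = trans (lookup-zipWith _∧_ x B⁺ (∁ B)) (cong (lookup B⁺ x ∧_) (lookup-map x not B))
    A∪E-at-x : lookup (A ∪ E) x ≡ (lookup A x ∨ e (ℓ x))
    A∪E-at-x = trans (lookup-zipWith _∨_ x A E) (cong (lookup A x ∨_) (E≡e x))

  private
    open ≤-Reasoning

    d[B]+d[B⁺]≤ : Empty (∂ 𝔸) → d G (B , B) + d G (B⁺ , B⁺) ≤ d G 𝔸 + (d G 𝔹 + d G 𝔹)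
    d[B]+d[B⁺]≤ ∂𝔸=∅ = begin
      d G (B , B) + d G (B⁺ , B⁺)
        ≡⟨ d+d≡Σ G (B , B) (B⁺ , B⁺) ⟩
      Σedges G (λ u v → dₑ (B , B) u v + dₑ (B⁺ , B⁺) u v)
        ≤⟨ Σedges-labelwise (insideBoundaryᵖ λ _ → false)
             (λ a b → cutᵖ Bᵖ a b + cutᵖ B⁺ᵖ a b) (λ a b → cutᵖ 𝔸ᵖ a b + (cutᵖ 𝔹ᵖ a b + cutᵖ 𝔹ᵖ a b))
             tt ℓ (insideBoundary {Subset.⊥} (λ _ → false) (λ x → lookup-replicate x false)
                                  (λ x∈∂ → contradiction (_ , x∈∂) ∂𝔸=∅)) G ⟩
      Σedges G (λ u v → dₑ 𝔸 u v + (dₑ 𝔹 u v + dₑ 𝔹 u v))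
        ≡⟨ Σedges-+ G (dₑ 𝔸) _ ⟩
      Σedges G (dₑ 𝔸) + Σedges G (λ u v → dₑ 𝔹 u v + dₑ 𝔹 u v)
        ≡⟨ cong₂ _+_ (d≡Σdₑ G 𝔸) (d+d≡Σ G 𝔹 𝔹) ⟨
      d G 𝔸 + (d G 𝔹 + d G 𝔹) ∎

    d[B⁺]≤ : ∂ 𝔸 ⊆ₛ B → d G (B⁺ , B⁺) ≤ d G 𝔸 + d G 𝔹
    d[B⁺]≤ ∂𝔸⊆B = begin
      d G (B⁺ , B⁺)
        ≡⟨ d≡Σdₑ G (B⁺ , B⁺) ⟩
      Σedges G (dₑ (B⁺ , B⁺))
        ≤⟨ Σedges-labelwise (insideBoundaryᵖ (proj₁ ∘ 𝔹ᵖ))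
             (cutᵖ B⁺ᵖ) (λ a b → cutᵖ 𝔸ᵖ a b + cutᵖ 𝔹ᵖ a b)
             tt ℓ (insideBoundary (proj₁ ∘ 𝔹ᵖ) (λ x → refl) ∂𝔸⊆B) G ⟩
      Σedges G (λ u v → dₑ 𝔸 u v + dₑ 𝔹 u v)
        ≡⟨ d+d≡Σ G 𝔸 𝔹 ⟨
      d G 𝔸 + d G 𝔹 ∎

    d[B]≤ : ∂ 𝔸 ⊆ₛ ∁ B⁺ → d G (B , B) ≤ d G 𝔸 + d G 𝔹
    d[B]≤ ∂𝔸⊆B* = begin
      d G (B , B)
        ≡⟨ d≡Σdₑ G (B , B) ⟩
      Σedges G (dₑ (B , B))
        ≤⟨ Σedges-labelwise (insideBoundaryᵖ (not ∘ proj₂ ∘ 𝔹ᵖ))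
             (cutᵖ Bᵖ) (λ a b → cutᵖ 𝔸ᵖ a b + cutᵖ 𝔹ᵖ a b)
             tt ℓ (insideBoundary (not ∘ proj₂ ∘ 𝔹ᵖ) (λ x → lookup-map x not B⁺) ∂𝔸⊆B*) G ⟩
      Σedges G (λ u v → dₑ 𝔸 u v + dₑ 𝔹 u v)
        ≡⟨ d+d≡Σ G 𝔸 𝔹 ⟨
      d G 𝔸 + d G 𝔹 ∎

    k∸1≤d[B] : k ∸ 1 ≤ d G (B , B)
    k∸1≤d[B] = ec B B≠∅ (map₂ (p⊆q⇒∁p⊇∁q B⊆B⁺) B*≠∅)

    k∸1≤d[B⁺] : k ∸ 1 ≤ d G (B⁺ , B⁺)
    k∸1≤d[B⁺] = ec B⁺ (map₂ B⊆B⁺ B≠∅) B*≠∅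

    k∸1≰0 : ¬ k ∸ 1 ≤ 0
    k∸1≰0 k∸1≤0 = contradiction (≤-trans 1≤k∸1 k∸1≤0) λ ()

  A⊆∂𝔹-absurd : ⊥
  A⊆∂𝔹-absurd with IsTight-cases k≥2 t𝔸
  ... | inj₁ (∣∂𝔸∣≡0 , d𝔸≡k∸1) = k∸1≰0 (+-cancelˡ-≤ (k ∸ 1) (k ∸ 1) 0 (begin
    (k ∸ 1) + (k ∸ 1)                 ≤⟨ +-mono-≤ k∸1≤d[B] k∸1≤d[B⁺] ⟩
    d G (B , B) + d G (B⁺ , B⁺)       ≤⟨ d[B]+d[B⁺]≤ (∣p∣≡0⇒Empty ∣∂𝔸∣≡0) ⟩
    d G 𝔸 + (d G 𝔹 + d G 𝔹)          ≡⟨ cong₂ (λ δ𝔸 δ𝔹 → δ𝔸 + (δ𝔹 + δ𝔹)) d𝔸≡k∸1 (proj₂ ∣∂𝔹∣≡1×d𝔹≡0) ⟩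
    (k ∸ 1) + 0                       ∎))
  ... | inj₂ (∣∂𝔸∣≡1 , d𝔸≡0) with ∣p∣≡1⇒Nonempty ∣∂𝔸∣≡1
  ...   | w , w∈∂𝔸 with w ∈? B
  ...     | yes w∈B = k∸1≰0 (subst (k ∸ 1 ≤_) d𝔸+d𝔹≡0 (≤-trans k∸1≤d[B⁺] (d[B⁺]≤ ∂𝔸⊆B)))
    where
    d𝔸+d𝔹≡0 = cong₂ _+_ d𝔸≡0 (proj₂ ∣∂𝔹∣≡1×d𝔹≡0)
    ∂𝔸⊆B : ∂ 𝔸 ⊆ₛ B
    ∂𝔸⊆B x∈∂𝔸 = subst (_∈ B) (∣p∣≤1⇒x≡y (≤-reflexive ∣∂𝔸∣≡1) w∈∂𝔸 x∈∂𝔸) w∈B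
  ...     | no  w∉B = k∸1≰0 (subst (k ∸ 1 ≤_) d𝔸+d𝔹≡0 (≤-trans k∸1≤d[B] (d[B]≤ ∂𝔸⊆B*)))
    where
    d𝔸+d𝔹≡0 = cong₂ _+_ d𝔸≡0 (proj₂ ∣∂𝔹∣≡1×d𝔹≡0)
    ∂𝔸⊆B* : ∂ 𝔸 ⊆ₛ ∁ B⁺
    ∂𝔸⊆B* x∈∂𝔸 = x∉p⇒x∈∁p λ x∈B⁺ → ∂∌ x∈∂𝔸 (∂𝔹⊆A (∈∂ x∈B⁺ λ x∈B →
      w∉B (subst (_∈ B) (∣p∣≤1⇒x≡y (≤-reflexive ∣∂𝔸∣≡1) x∈∂𝔸 w∈∂𝔸) x∈B)))

disjoint⇒escapes : ∀ {Q : Subset n} → 2 ≤ k → EdgeConnected (k ∸ 1) G → ∀ {A A⁺ B B⁺} →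
  IsTight k G Q (A , A⁺) → IsTight k G Q (B , B⁺) → Empty (A ∩ B) → Nonempty (A ∩ ∁ B⁺)
disjoint⇒escapes k≥2 ec {A} {A⁺} {B} {B⁺} t𝔸 t𝔹 A∩B=∅ with nonempty? (A ∩ ∁ B⁺)
... | yes A∖B⁺≠∅ = A∖B⁺≠∅
... | no  A∖B⁺=∅ = ⊥-elim (A⊆∂𝔹-absurd k≥2 ec t𝔸 t𝔹 A∩B=∅ A⊆B⁺)
  where
  A⊆B⁺ : A ⊆ₛ B⁺
  A⊆B⁺ {x} x∈A with x ∈? B⁺
  ... | yes x∈B⁺ = x∈B⁺
  ... | no  x∉B⁺ = contradiction (x , x∈p∩q⁺ (x∈A , x∉p⇒x∈∁p x∉B⁺)) A∖B⁺=∅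

IsTight-cross⊎cocross : ∀ {Q : Subset n} → 2 ≤ k → EdgeConnected (k ∸ 1) G → ∀ {𝔸 𝔹} →
  IsTight k G Q 𝔸 → IsTight k G Q 𝔹 → Cross 𝔸 𝔹 ⊎ CoCross 𝔸 𝔹
IsTight-cross⊎cocross k≥2 ec {A , A⁺} {B , B⁺} t𝔸 t𝔹
  with nonempty? (A ∩ B) | nonempty? (∁ (A⁺ ∪ B⁺))
... | no A∩B=∅ | _ =
  inj₂ (disjoint⇒escapes k≥2 ec t𝔸 t𝔹 A∩B=∅ , disjoint⇒escapes k≥2 ec t𝔹 t𝔸 (Empty-∩-comm A∩B=∅))
... | yes A∩B≠∅ | yes ∁[A⁺∪B⁺]≠∅ = inj₁ (A∩B≠∅ , ∁-nonempty⇒≢⊤ ∁[A⁺∪B⁺]≠∅)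
... | yes _ | no ∁[A⁺∪B⁺]=∅ = inj₂
  ( subst Nonempty (∁∩∁∁ B⁺ A) (escapes (IsTight-cobiset t𝔹) (IsTight-cobiset t𝔸) (Empty-∩-comm A*∩B*=∅))
  , subst Nonempty (∁∩∁∁ A⁺ B) (escapes (IsTight-cobiset t𝔸) (IsTight-cobiset t𝔹) A*∩B*=∅))
  where
  escapes = disjoint⇒escapes k≥2 ec
  A*∩B*=∅ : Empty (∁ A⁺ ∩ ∁ B⁺)
  A*∩B*=∅ = ∁[A⁺∪B⁺]=∅ ∘ subst Nonempty (sym (∁-∪ A⁺ B⁺))

module _ {k : ℕ} {G : Graph n} {Q : Subset n} (ec : EdgeConnected (k ∸ 1) G) where

  Core⇒⊆ : ∀ {ℂ 𝔹} → Core k G Q ℂ → IsTight k G Q 𝔹 → Cross ℂ 𝔹 → ℂ ⊆b 𝔹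
  Core⇒⊆ {C , C⁺} {B , B⁺} (tℂ , minimal) t𝔹 cross =
    let ℂ∩𝔹-tight = IsTight⇒Tight (proj₁ (IsTight-∩∪ ec (Tight⇒IsTight tℂ) t𝔹 cross))
        C⊆C∩B , C⁺⊆C⁺∩B⁺ = minimal (C ∩ B , C⁺ ∩ B⁺) ℂ∩𝔹-tight (p∩q⊆p C B , p∩q⊆p C⁺ B⁺)
    in p∩q⊆q C B ∘ C⊆C∩B , p∩q⊆q C⁺ B⁺ ∘ C⁺⊆C⁺∩B⁺

  Core⇒⊆⊎⊆* : 2 ≤ k → ∀ {𝔸 ℂ} → IsTight k G Q 𝔸 → Core k G Q ℂ → ℂ ⊆b 𝔸 ⊎ ℂ ⊆b cobiset 𝔸
  Core⇒⊆⊎⊆* k≥2 {A , A⁺} {C , C⁺} t𝔸 core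
    with IsTight-cross⊎cocross k≥2 ec (Tight⇒IsTight (proj₁ core)) t𝔸
  ... | inj₁ cross = inj₁ (Core⇒⊆ core t𝔸 cross)
  ... | inj₂ (C∖A⁺≠∅ , A∖C⁺≠∅) =
    inj₂ (Core⇒⊆ core (IsTight-cobiset t𝔸) (C∖A⁺≠∅ , ∁-nonempty⇒≢⊤ ∁[C⁺∪A*]≠∅))
    where
    ∁[C⁺∪A*]≠∅ : Nonempty (∁ (C⁺ ∪ ∁ A))
    ∁[C⁺∪A*]≠∅ = let x , x∈A∖C⁺ = A∖C⁺≠∅ ; x∈A , x∈C* = x∈p∩q⁻ A (∁ C⁺) x∈A∖C⁺ in
      x , x∉p⇒x∈∁p ([ x∈∁p⇒x∉p x∈C* , x∈p⇒x∉∁p x∈A ] ∘ x∈p∪q⁻ C⁺ (∁ A))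

lemma3 : ∀ {n} (k : ℕ) (G : Graph n) (Q : Subset n) → 2 ≤ k → EdgeConnected (k ∸ 1) G →
    (∀ 𝔸 → Tight k G Q 𝔸 → Tight k G Q (cobiset 𝔸))
    × (∀ 𝔸 𝔹 → Tight k G Q 𝔸 → Tight k G Q 𝔹 → Cross 𝔸 𝔹 →
         Tight k G Q (𝔸 ∩b 𝔹) × Tight k G Q (𝔸 ∪b 𝔹))
    × (∀ 𝔸 𝔹 → Tight k G Q 𝔸 → Tight k G Q 𝔹 → Cross 𝔸 𝔹 ⊎ CoCross 𝔸 𝔹)
    × (∀ 𝔸 ℂ → Tight k G Q 𝔸 → Core k G Q ℂ → ℂ ⊆b 𝔸 ⊎ ℂ ⊆b cobiset 𝔸)
lemma3 k G Q k≥2 ec =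
    (λ 𝔸 t𝔸 → ↓ (IsTight-cobiset (↑ t𝔸)))
  , (λ 𝔸 𝔹 t𝔸 t𝔹 cross → Data.Product.map ↓ ↓ (IsTight-∩∪ ec (↑ t𝔸) (↑ t𝔹) cross))
  , (λ 𝔸 𝔹 t𝔸 t𝔹 → IsTight-cross⊎cocross k≥2 ec (↑ t𝔸) (↑ t𝔹))
  , (λ 𝔸 ℂ t𝔸 → Core⇒⊆⊎⊆* ec k≥2 (↑ t𝔸))
  where
  ↑ : ∀ {𝔸} → Tight k G Q 𝔸 → IsTight k G Q 𝔸
  ↑ = Tight⇒IsTight
  ↓ : ∀ {𝔸} → IsTight k G Q 𝔸 → Tight k G Q 𝔸
  ↓ = IsTight⇒Tight
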